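{- Let $J$ be an instance of $1||\sum w_jU_j$ with $d_{\#}$ distinct due dates and maximum weight $w_{\max}$, let $A$ be the solution vector of $J$ and $A'$ the fractional solution vector of $J$. Then $0\le A'[k]-A[k]\le d_{\#}w_{\max}$ for every index $k$.
   Context: An instance consists of jobs $J=\{1,\ldots,n\}$ with processing times $p_j\in\mathbb{N}$, weights $w_j\in\mathbb{N}$, due dates $d_j\in\mathbb{N}$; $d_{\max}=\max_j d_j$, $w_{\max}=\max_j w_j$, $d_{\#}=|\{d_j\}|$. In a single-machine schedule (permutation $\sigma$), job $j$ has completion time $C_j=\sum_{i:\sigma(i)\le\sigma(j)}p_i$ and is early if $C_j\le d_j$. The solution vector of $J$ is $(A[k])_{k=0}^{d_{\max}}$ where $A[k]$ is the maximum total weight of a set of jobs of total processing time at most $k$ that can all be early in some schedule. A feasible fractional solution is a vector of reals $0\le x_1,\ldots,x_n\le 1$ with $\sum_{\ell: d_\ell\le d_j}p_\ell x_\ell\le d_j$ for all $j\in J$. The fractional solution vector of $J$ is $(A'[k])_{k=0}^{d_{\max}}$ where $A'[k]$ is the maximum of $\sum_j w_jx_j$ over all feasible fractional solutions with $\sum_j p_jx_j\le k$.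
   Formalization: The feasible fractional solutions, and with them the values $A'[k]$, are taken over the rationals instead of the reals. -}

module Defs where

open import Data.Nat as ℕ using (ℕ; zero; suc; _⊔_; _≤ᵇ_) renaming (_+_ to _+ℕ_; _≤_ to _≤ℕ_)
open import Data.Nat.Properties using (_≟_)
open import Data.Fin using (Fin; zero; suc; toℕ)
open import Data.List using (List; length; map; foldr; deduplicate)
open import Data.List.Base using (allFin)
open import Data.Bool using (Bool; true; false; if_then_else_; T)
open import Data.Product using (Σ; ∃; _×_; _,_)
open import Data.Integer using (+_)
open import Data.Rational using (ℚ; 0ℚ; 1ℚ; _/_) renaming (_+_ to _+ℚ_; _*_ to _*ℚ_; _≤_ to _≤ℚ_)
open import Function.Bundles using (_↔_; Inverse)

record Instance : Set where
  field
    n : ℕ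
    p : Fin n → ℕ
    w : Fin n → ℕ
    d : Fin n → ℕ
open Instance public

sumℕ : ∀ {m} → (Fin m → ℕ) → ℕ
sumℕ {zero} f = 0
sumℕ {suc m} f = f zero +ℕ sumℕ (λ i → f (suc i))

sumℚ : ∀ {m} → (Fin m → ℚ) → ℚ
sumℚ {zero} f = 0ℚ
sumℚ {suc m} f = f zero +ℚ sumℚ (λ i → f (suc i))

maxℕ : ∀ {m} → (Fin m → ℕ) → ℕ
maxℕ {zero} f = 0
maxℕ {suc m} f = f zero ⊔ maxℕ (λ i → f (suc i))

ℕ→ℚ : ℕ → ℚ
ℕ→ℚ k = + k / 1

dmax : Instance → ℕ
dmax J = maxℕ (d J)

wmax : Instance → ℕ
wmax J = maxℕ (w J)

dnum : Instance → ℕ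
dnum J = length (deduplicate _≟_ (map (d J) (allFin (n J))))

-- A schedule: a permutation σ of the jobs; σ j is the position of job j.
Schedule : Instance → Set
Schedule J = Fin (n J) ↔ Fin (n J)

C : (J : Instance) → Schedule J → Fin (n J) → ℕ
C J σ j = sumℕ (λ i → if toℕ (Inverse.to σ i) ≤ᵇ toℕ (Inverse.to σ j) then p J i else 0)

AllEarly : (J : Instance) → (Fin (n J) → Bool) → Set
AllEarly J S = Σ (Schedule J) λ σ → ∀ j → T (S j) → C J σ j ≤ℕ d J j

pSet : (J : Instance) → (Fin (n J) → Bool) → ℕ
pSet J S = sumℕ (λ j → if S j then p J j else 0)

wSet : (J : Instance) → (Fin (n J) → Bool) → ℕ
wSet J S = sumℕ (λ j → if S j then w J j else 0)

IsA : (J : Instance) → ℕ → ℕ → Set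
IsA J k a =
  (Σ (Fin (n J) → Bool) λ S → AllEarly J S × pSet J S ≤ℕ k × wSet J S ≡ a)
  × (∀ S → AllEarly J S → pSet J S ≤ℕ k → wSet J S ≤ℕ a)
  where open import Relation.Binary.PropositionalEquality using (_≡_)

FracFeasible : (J : Instance) → (Fin (n J) → ℚ) → Set
FracFeasible J x =
  (∀ j → (0ℚ ≤ℚ x j) × (x j ≤ℚ 1ℚ))
  × (∀ j → sumℚ (λ l → if d J l ≤ᵇ d J j then ℕ→ℚ (p J l) *ℚ x l else 0ℚ) ≤ℚ ℕ→ℚ (d J j))

pFrac : (J : Instance) → (Fin (n J) → ℚ) → ℚ
pFrac J x = sumℚ (λ j → ℕ→ℚ (p J j) *ℚ x j)

wFrac : (J : Instance) → (Fin (n J) → ℚ) → ℚ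
wFrac J x = sumℚ (λ j → ℕ→ℚ (w J j) *ℚ x j)

IsA' : (J : Instance) → ℕ → ℚ → Set
IsA' J k a' =
  (Σ (Fin (n J) → ℚ) λ x → FracFeasible J x × pFrac J x ≤ℚ ℕ→ℚ k × wFrac J x ≡ a')
  × (∀ x → FracFeasible J x → pFrac J x ≤ℚ ℕ→ℚ k → wFrac J x ≤ℚ a')
  where open import Relation.Binary.PropositionalEquality using (_≡_)

{-# OPTIONS --safe #-}
module Submission where

open import Defs
open import Data.Nat using (ℕ; _≤_; _*_)
open import Data.Product using (_×_)
open import Data.Rational using (ℚ; 0ℚ) renaming (_≤_ to _≤ℚ_; _-_ to _-ℚ_)

open import Data.Bool using (Bool; true; false; T; if_then_else_; _∧_; _∨_; not)
open import Data.Bool.Properties using (T?; T-≡; T-∧; T-∨; if-float; ∧-identityʳ; ∧-zeroʳ; ∧-distribˡ-∨)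
open import Data.Empty using (⊥; ⊥-elim)
open import Data.Fin using (Fin; zero; suc; toℕ)
import Data.Fin as Fin
import Data.Fin.Properties as Fin
open import Data.Integer using (+_)
import Data.Integer as ℤ
import Data.Integer.Properties as ℤ
open import Data.List using (List; []; _∷_; length; map; deduplicate; allFin)
open import Data.List.Membership.Propositional.Properties using (∈-map⁺; ∈-allFin; ∈-deduplicate⁺)
open import Data.Nat using (zero; suc; _+_; _<_; _≥_; _≤ᵇ_; _<ᵇ_; _≡ᵇ_; z≤n; s≤s)
import Data.Nat as ℕ
import Data.Nat.Coprimality as Coprime
import Data.Nat.Properties as ℕ
open import Data.List.Membership.DecPropositional ℕ._≟_ using (_∈_; _∈?_)
open import Data.Product using (Σ; ∃; _,_; proj₁; proj₂)
open import Data.Rational using (1ℚ; mkℚ; _/_) renaming (_+_ to _+ℚ_; _*_ to _*ℚ_; _<_ to _<ℚ_)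
import Data.Rational as ℚ
import Data.Rational.Properties as ℚ
open import Data.Rational.Solver using (module +-*-Solver)
open import Data.Sum as Sum using (_⊎_; inj₁; inj₂; [_,_]′; reduce)
open import Function using (_∘_; id; flip; Injective)
open import Function.Bundles using (_↔_; Inverse; Equivalence; mk↔ₛ′)
open import Relation.Binary using (Rel; Total; Transitive; tri<; tri≈; tri>)
open import Relation.Binary.PropositionalEquality
open import Relation.Nullary using (¬_; Dec; yes; no; does)
open import Relation.Nullary.Decidable using (dec-true)

-- Lower bound: if all jobs of S are early in some schedule, those due by D complete by time
-- D, so the indicator vector of S is a feasible fractional solution.
-- Upper bound: round an optimal fractional solution x separately on each class of jobs
-- sharing a due date.  Inside a class, take jobs greedily by density w/p while their total
-- processing time stays within the class's fractional processing time; as for the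
-- fractional knapsack, this loses the weight of at most one job, i.e. at most w_max.  The
-- rounded set S never uses more processing time than x on any union of due-date classes;
-- on the prefixes {j | d_j ≤ D} this makes S schedulable early (in EDD order), and on all
-- jobs it gives p(S) ≤ k.  Hence A[k] ≥ w(S) ≥ A'[k] - d_# w_max.

private
  variable
    m : ℕ

ℕ→ℚ≡mkℚ : ∀ k → ℕ→ℚ k ≡ mkℚ (+ k) 0 (Coprime.sym (Coprime.1-coprimeTo k))
ℕ→ℚ≡mkℚ k = ℚ.↥p/↧p≡p (mkℚ (+ k) 0 _)

ℕ→ℚ-homo-+ : ∀ a b → ℕ→ℚ (a + b) ≡ ℕ→ℚ a +ℚ ℕ→ℚ b
ℕ→ℚ-homo-+ a b = begin
  + (a + b) / 1                       ≡⟨ cong (_/ 1) (ℤ.pos-+ a b) ⟩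
  (+ a ℤ.+ + b) / 1                   ≡⟨ cong (_/ 1) (cong₂ ℤ._+_ (ℤ.*-identityʳ (+ a)) (ℤ.*-identityʳ (+ b))) ⟨
  (+ a ℤ.* + 1 ℤ.+ + b ℤ.* + 1) / 1   ≡⟨ cong₂ _+ℚ_ (ℕ→ℚ≡mkℚ a) (ℕ→ℚ≡mkℚ b) ⟨
  ℕ→ℚ a +ℚ ℕ→ℚ b                      ∎
  where open ≡-Reasoning

ℕ→ℚ-homo-* : ∀ a b → ℕ→ℚ (a * b) ≡ ℕ→ℚ a *ℚ ℕ→ℚ b
ℕ→ℚ-homo-* a b = begin
  + (a * b) / 1      ≡⟨ cong (_/ 1) (ℤ.pos-* a b) ⟩
  (+ a ℤ.* + b) / 1  ≡⟨ cong₂ _*ℚ_ (ℕ→ℚ≡mkℚ a) (ℕ→ℚ≡mkℚ b) ⟨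
  ℕ→ℚ a *ℚ ℕ→ℚ b     ∎
  where open ≡-Reasoning

ℕ→ℚ-mono-≤ : ∀ {a b} → a ≤ b → ℕ→ℚ a ≤ℚ ℕ→ℚ b
ℕ→ℚ-mono-≤ {a} {b} a≤b rewrite ℕ→ℚ≡mkℚ a | ℕ→ℚ≡mkℚ b =
  ℚ.*≤* (ℤ.*-monoʳ-≤-nonNeg (+ 1) (ℤ.+≤+ a≤b))

ℕ→ℚ-cancel-≤ : ∀ {a b} → ℕ→ℚ a ≤ℚ ℕ→ℚ b → a ≤ b
ℕ→ℚ-cancel-≤ {a} {b} a≤b rewrite ℕ→ℚ≡mkℚ a | ℕ→ℚ≡mkℚ b =
  ℤ.drop‿+≤+ (subst₂ ℤ._≤_ (ℤ.*-identityʳ (+ a)) (ℤ.*-identityʳ (+ b)) (ℚ.drop-*≤* a≤b))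

0≤ℕ→ℚ : ∀ k → 0ℚ ≤ℚ ℕ→ℚ k
0≤ℕ→ℚ k = ℕ→ℚ-mono-≤ {0} {k} z≤n

ℕ→ℚ-pos : ∀ {k} → 0 < k → ℚ.Positive (ℕ→ℚ k)
ℕ→ℚ-pos {suc k} _ = ℚ.normalize-pos (suc k) 1

p≤q⇒0≤q-p : ∀ {p q} → p ≤ℚ q → 0ℚ ≤ℚ q -ℚ p
p≤q⇒0≤q-p {p} {q} p≤q = subst (_≤ℚ q -ℚ p) (ℚ.+-inverseʳ p) (ℚ.+-monoˡ-≤ (ℚ.- p) p≤q)

p+q-p≡q : ∀ p q → p +ℚ q -ℚ p ≡ q
p+q-p≡q = solve 2 (λ p q → p :+ q :- p := q) refl
  where open +-*-Solver

q≤p+r⇒q-p≤r : ∀ {p q r} → q ≤ℚ p +ℚ r → q -ℚ p ≤ℚ r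
q≤p+r⇒q-p≤r {p} {q} {r} q≤p+r = subst (q -ℚ p ≤ℚ_) (p+q-p≡q p r) (ℚ.+-monoˡ-≤ (ℚ.- p) q≤p+r)

+-cancelʳ-≤ : ∀ {p q} r → p +ℚ r ≤ℚ q +ℚ r → p ≤ℚ q
+-cancelʳ-≤ {p} {q} r p+r≤q+r = subst₂ _≤ℚ_ (s+r-r≡s p) (s+r-r≡s q) (ℚ.+-monoˡ-≤ (ℚ.- r) p+r≤q+r)
  where
  s+r-r≡s : ∀ s → s +ℚ r -ℚ r ≡ s
  s+r-r≡s s = trans (cong (_-ℚ r) (ℚ.+-comm s r)) (p+q-p≡q r s)

p≤p+q : ∀ {p q} → 0ℚ ≤ℚ q → p ≤ℚ p +ℚ q
p≤p+q {p} {q} 0≤q = subst (_≤ℚ p +ℚ q) (ℚ.+-identityʳ p) (ℚ.+-monoʳ-≤ p 0≤q)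

sumℕ-mono : ∀ {f g : Fin m → ℕ} → (∀ i → f i ≤ g i) → sumℕ f ≤ sumℕ g
sumℕ-mono {zero}  f≤g = z≤n
sumℕ-mono {suc m} f≤g = ℕ.+-mono-≤ (f≤g zero) (sumℕ-mono (f≤g ∘ suc))

sumℕ-mono-< : ∀ {f g : Fin m → ℕ} → (∀ i → f i ≤ g i) → ∀ r → f r < g r → sumℕ f < sumℕ g
sumℕ-mono-< f≤g zero    fr<gr = ℕ.+-mono-<-≤ fr<gr (sumℕ-mono (f≤g ∘ suc))
sumℕ-mono-< f≤g (suc r) fr<gr = ℕ.+-mono-≤-< (f≤g zero) (sumℕ-mono-< (f≤g ∘ suc) r fr<gr)

sumℕ-const : ∀ m c → sumℕ {m} (λ _ → c) ≡ m * c
sumℕ-const zero    c = refl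
sumℕ-const (suc m) c = cong (_+_ c) (sumℕ-const m c)

sumℚ-cong : ∀ {f g : Fin m → ℚ} → (∀ i → f i ≡ g i) → sumℚ f ≡ sumℚ g
sumℚ-cong {zero}  f≡g = refl
sumℚ-cong {suc m} f≡g = cong₂ _+ℚ_ (f≡g zero) (sumℚ-cong (f≡g ∘ suc))

sumℚ-mono : ∀ {f g : Fin m → ℚ} → (∀ i → f i ≤ℚ g i) → sumℚ f ≤ℚ sumℚ g
sumℚ-mono {zero}  f≤g = ℚ.≤-refl
sumℚ-mono {suc m} f≤g = ℚ.+-mono-≤ (f≤g zero) (sumℚ-mono (f≤g ∘ suc))

sumℚ-zero : ∀ m → sumℚ {m} (λ _ → 0ℚ) ≡ 0ℚ
sumℚ-zero zero    = refl
sumℚ-zero (suc m) = cong (0ℚ +ℚ_) (sumℚ-zero m)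

sumℚ-+ : ∀ (f g : Fin m → ℚ) → sumℚ (λ i → f i +ℚ g i) ≡ sumℚ f +ℚ sumℚ g
sumℚ-+ {zero}  f g = refl
sumℚ-+ {suc m} f g = trans (cong (f zero +ℚ g zero +ℚ_) (sumℚ-+ (f ∘ suc) (g ∘ suc)))
                           (interchange (f zero) (g zero) (sumℚ (f ∘ suc)) (sumℚ (g ∘ suc)))
  where
  open +-*-Solver
  interchange : ∀ a b c d → (a +ℚ b) +ℚ (c +ℚ d) ≡ (a +ℚ c) +ℚ (b +ℚ d)
  interchange = solve 4 (λ a b c d → (a :+ b) :+ (c :+ d) := (a :+ c) :+ (b :+ d)) refl

sumℚ-*ˡ : ∀ c (f : Fin m → ℚ) → sumℚ (λ i → c *ℚ f i) ≡ c *ℚ sumℚ f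
sumℚ-*ˡ {zero}  c f = sym (ℚ.*-zeroʳ c)
sumℚ-*ˡ {suc m} c f = trans (cong (c *ℚ f zero +ℚ_) (sumℚ-*ˡ c (f ∘ suc)))
                            (sym (ℚ.*-distribˡ-+ c (f zero) (sumℚ (f ∘ suc))))

sumℚ-linear : ∀ a b (f g : Fin m → ℚ) → sumℚ (λ i → a *ℚ f i +ℚ b *ℚ g i) ≡ a *ℚ sumℚ f +ℚ b *ℚ sumℚ g
sumℚ-linear a b f g = trans (sumℚ-+ (λ i → a *ℚ f i) (λ i → b *ℚ g i)) (cong₂ _+ℚ_ (sumℚ-*ˡ a f) (sumℚ-*ˡ b g))

ℕ→ℚ-sumℕ : ∀ (f : Fin m → ℕ) → ℕ→ℚ (sumℕ f) ≡ sumℚ (ℕ→ℚ ∘ f)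
ℕ→ℚ-sumℕ {zero}  f = refl
ℕ→ℚ-sumℕ {suc m} f = trans (ℕ→ℚ-homo-+ (f zero) _) (cong (ℕ→ℚ (f zero) +ℚ_) (ℕ→ℚ-sumℕ (f ∘ suc)))

maxℕ-upper : ∀ (f : Fin m → ℕ) i → f i ≤ maxℕ f
maxℕ-upper f zero    = ℕ.m≤m⊔n (f zero) (maxℕ (f ∘ suc))
maxℕ-upper f (suc i) = ℕ.≤-trans (maxℕ-upper (f ∘ suc) i) (ℕ.m≤n⊔m (f zero) (maxℕ (f ∘ suc)))

Subset : ℕ → Set
Subset m = Fin m → Bool

∅ : Subset m
∅ _ = false

⁅_⁆ : Fin m → Subset m
⁅ r ⁆ i = does (i Fin.≟ r)

infixr 7 _∩_
infixr 6 _∪_ _∖_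
infix 4 _⊆_

_∩_ _∪_ _∖_ : Subset m → Subset m → Subset m
(A ∩ B) i = A i ∧ B i
(A ∪ B) i = A i ∨ B i
(A ∖ B) i = A i ∧ not (B i)

_⊆_ : Subset m → Subset m → Set
A ⊆ B = ∀ i → T (A i) → T (B i)

Disjoint : Subset m → Subset m → Set
Disjoint A B = ∀ i → T (A i) → T (B i) → ⊥

∑ℕ⟨_⟩_ : Subset m → (Fin m → ℕ) → ℕ
∑ℕ⟨ A ⟩ f = sumℕ (λ i → if A i then f i else 0)

∣_∣ : Subset m → ℕ
∣ A ∣ = ∑ℕ⟨ A ⟩ (λ _ → 1)

∑⟨_⟩_ : Subset m → (Fin m → ℚ) → ℚ
∑⟨ A ⟩ f = sumℚ (λ i → if A i then f i else 0ℚ)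

𝟙 : Subset m → Fin m → ℚ
𝟙 A i = if A i then 1ℚ else 0ℚ

infixl 7 _·_
_·_ : (Fin m → ℕ) → (Fin m → ℚ) → Fin m → ℚ
(f · x) i = ℕ→ℚ (f i) *ℚ x i

private
  if-T : ∀ {a} {A : Set a} {b} {x y : A} → T b → (if b then x else y) ≡ x
  if-T {b = true} _ = refl

  if-F : ∀ {a} {A : Set a} {b} {x y : A} → ¬ T b → (if b then x else y) ≡ y
  if-F {b = false} _  = refl
  if-F {b = true}  ¬b = ⊥-elim (¬b _)

  T-∧⁻ : ∀ {a b} → T (a ∧ b) → T a × T b
  T-∧⁻ = Equivalence.to T-∧

  T-∧⁺ : ∀ {a b} → T a → T b → T (a ∧ b)
  T-∧⁺ ta tb = Equivalence.from T-∧ (ta , tb)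

  T-∨⁻ : ∀ {a b} → T (a ∨ b) → T a ⊎ T b
  T-∨⁻ = Equivalence.to T-∨

  T-∨⁺ : ∀ {a b} → T a ⊎ T b → T (a ∨ b)
  T-∨⁺ = Equivalence.from T-∨

  T-∖⁻ : ∀ {a b} → T (a ∧ not b) → T a × ¬ T b
  T-∖⁻ {true} {false} _ = _ , λ ()

  T-∖⁺ : ∀ {a b} → T a → ¬ T b → T (a ∧ not b)
  T-∖⁺ {true} {false} _ _  = _
  T-∖⁺ {true} {true}  _ ¬b = ¬b _

  if-mono-ℕ : ∀ a b {x} → (T a → T b) → (if a then x else 0) ≤ (if b then x else 0)
  if-mono-ℕ true  true  _ = ℕ.≤-refl
  if-mono-ℕ true  false h = ⊥-elim (h _)
  if-mono-ℕ false _     _ = z≤n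

⁅⁆-sound : ∀ {i r : Fin m} → T (⁅ r ⁆ i) → i ≡ r
⁅⁆-sound {i = i} {r} i∈⁅r⁆ with i Fin.≟ r
... | yes i≡r = i≡r

⁅⁆-complete : ∀ (r : Fin m) → T (⁅ r ⁆ r)
⁅⁆-complete r with r Fin.≟ r
... | yes _   = _
... | no  r≢r = r≢r refl

∪-⊆ˡ : ∀ {A B : Subset m} → A ⊆ A ∪ B
∪-⊆ˡ _ = T-∨⁺ ∘ inj₁

∪-mono-⊆ : ∀ {A B C D : Subset m} → A ⊆ B → C ⊆ D → A ∪ C ⊆ B ∪ D
∪-mono-⊆ {A = A} {B} {C} {D} A⊆B C⊆D i = T-∨⁺ {B i} {D i} ∘ Sum.map (A⊆B i) (C⊆D i) ∘ T-∨⁻ {A i} {C i}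

∖-antimono : ∀ {A B C : Subset m} → B ⊆ C → A ∖ C ⊆ A ∖ B
∖-antimono B⊆C i i∈A∖C = T-∖⁺ (proj₁ (T-∖⁻ i∈A∖C)) (proj₂ (T-∖⁻ i∈A∖C) ∘ B⊆C i)

∖⊆∅⇒⊆ : ∀ {A B : Subset m} → A ∖ B ⊆ ∅ → A ⊆ B
∖⊆∅⇒⊆ {B = B} A∖B⊆∅ i i∈A with T? (B i)
... | yes i∈B = i∈B
... | no  i∉B = ⊥-elim (A∖B⊆∅ i (T-∖⁺ i∈A i∉B))

∑ℕ-mono-⊆ : ∀ {A B : Subset m} f → A ⊆ B → ∑ℕ⟨ A ⟩ f ≤ ∑ℕ⟨ B ⟩ f
∑ℕ-mono-⊆ {A = A} {B} f A⊆B = sumℕ-mono (λ i → if-mono-ℕ (A i) (B i) (A⊆B i))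

∑ℕ-∅ : ∀ f → ∑ℕ⟨ ∅ {m} ⟩ f ≡ 0
∑ℕ-∅ {m} f = trans (sumℕ-const m 0) (ℕ.*-zeroʳ m)

∣∣-mono-⊂ : ∀ {A B : Subset m} r → A ⊆ B → T (B r) → ¬ T (A r) → ∣ A ∣ < ∣ B ∣
∣∣-mono-⊂ {A = A} {B} r A⊆B r∈B r∉A =
  sumℕ-mono-< (λ i → if-mono-ℕ (A i) (B i) (A⊆B i)) r (strict (A r) (B r) r∉A r∈B)
  where
  strict : ∀ a b → ¬ T a → T b → (if a then 1 else 0) < (if b then 1 else 0)
  strict false true _  _ = s≤s z≤n
  strict true  _    ¬a _ = ⊥-elim (¬a _)

∑-cong : ∀ {A B : Subset m} f → A ≗ B → ∑⟨ A ⟩ f ≡ ∑⟨ B ⟩ f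
∑-cong f A≗B = sumℚ-cong (λ i → cong (λ b → if b then f i else 0ℚ) (A≗B i))

∑-mono : ∀ {A B : Subset m} {f g} → (∀ i → 0ℚ ≤ℚ g i) → A ⊆ B → (∀ i → T (A i) → f i ≤ℚ g i) →
         ∑⟨ A ⟩ f ≤ℚ ∑⟨ B ⟩ g
∑-mono {A = A} {B} 0≤g A⊆B f≤g = sumℚ-mono (λ i → if-mono (A i) (B i) (0≤g i) (A⊆B i) (f≤g i))
  where
  if-mono : ∀ a b {x y} → 0ℚ ≤ℚ y → (T a → T b) → (T a → x ≤ℚ y) →
            (if a then x else 0ℚ) ≤ℚ (if b then y else 0ℚ)
  if-mono true  true  _   _ x≤y = x≤y _
  if-mono true  false _   h _   = ⊥-elim (h _)
  if-mono false true  0≤y _ _   = 0≤y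
  if-mono false false _   _ _   = ℚ.≤-refl

∑-∪ : ∀ {A B : Subset m} f → Disjoint A B → ∑⟨ A ∪ B ⟩ f ≡ ∑⟨ A ⟩ f +ℚ ∑⟨ B ⟩ f
∑-∪ {A = A} {B} f A∩B=∅ =
  trans (sumℚ-cong (λ i → split (A i) (B i) (A∩B=∅ i))) (sumℚ-+ (λ i → if A i then f i else 0ℚ) _)
  where
  split : ∀ a b {x} → (T a → T b → ⊥) → (if a ∨ b then x else 0ℚ) ≡ (if a then x else 0ℚ) +ℚ (if b then x else 0ℚ)
  split true  true  disj = ⊥-elim (disj _ _)
  split true  false _    = sym (ℚ.+-identityʳ _)
  split false _     _    = sym (ℚ.+-identityˡ _)

∑-∩-∪ : ∀ {Q A B : Subset m} f → Disjoint A B → ∑⟨ Q ∩ (A ∪ B) ⟩ f ≡ ∑⟨ Q ∩ A ⟩ f +ℚ ∑⟨ Q ∩ B ⟩ f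
∑-∩-∪ {Q = Q} {A} {B} f A∩B=∅ =
  trans (∑-cong f (λ i → ∧-distribˡ-∨ (Q i) (A i) (B i)))
        (∑-∪ f (λ i i∈Q∩A i∈Q∩B → A∩B=∅ i (proj₂ (T-∧⁻ {Q i} i∈Q∩A)) (proj₂ (T-∧⁻ {Q i} i∈Q∩B))))

∑-∩-const-mono : ∀ {Q A B : Subset m} {f g} b → (∀ i → T (B i) → Q i ≡ b) → A ⊆ B →
                 ∑⟨ A ⟩ f ≤ℚ ∑⟨ B ⟩ g → ∑⟨ Q ∩ A ⟩ f ≤ℚ ∑⟨ Q ∩ B ⟩ g
∑-∩-const-mono {Q = Q} {A} {B} {f} {g} b Q≡b A⊆B A≤B =
  subst₂ _≤ℚ_ (∑-cong f (λ i → sym (∧-const (Q i) (A i) (Q≡b i ∘ A⊆B i))))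
              (∑-cong g (λ i → sym (∧-const (Q i) (B i) (Q≡b i))))
              (restricted b)
  where
  ∧-const : ∀ q a {b} → (T a → q ≡ b) → q ∧ a ≡ b ∧ a
  ∧-const q true      q≡b = cong (_∧ true) (q≡b _)
  ∧-const q false {b} _   = trans (∧-zeroʳ q) (sym (∧-zeroʳ b))
  restricted : ∀ b → ∑⟨ (λ _ → b) ∩ A ⟩ f ≤ℚ ∑⟨ (λ _ → b) ∩ B ⟩ g
  restricted true  = A≤B
  restricted false = ℚ.≤-refl

∑-⁅⁆ : ∀ (f : Fin m → ℚ) r → ∑⟨ ⁅ r ⁆ ⟩ f ≡ f r
∑-⁅⁆ {suc m} f zero    = trans (cong (f zero +ℚ_) (sumℚ-zero m)) (ℚ.+-identityʳ (f zero))
∑-⁅⁆ {suc m} f (suc r) = trans (ℚ.+-identityˡ _) (∑-⁅⁆ (f ∘ suc) r)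

∑-ℕ→ℚ : ∀ (A : Subset m) f → ∑⟨ A ⟩ (ℕ→ℚ ∘ f) ≡ ℕ→ℚ (∑ℕ⟨ A ⟩ f)
∑-ℕ→ℚ A f = trans (sumℚ-cong (λ i → sym (if-float ℕ→ℚ (A i) {f i} {0})))
                  (sym (ℕ→ℚ-sumℕ (λ i → if A i then f i else 0)))

∑-·𝟙 : ∀ (A S : Subset m) f → ∑⟨ A ⟩ (f · 𝟙 S) ≡ ∑⟨ A ∩ S ⟩ (ℕ→ℚ ∘ f)
∑-·𝟙 A S f = sumℚ-cong (λ i → mask (A i) (S i))
  where
  mask : ∀ a s {y} → (if a then y *ℚ (if s then 1ℚ else 0ℚ) else 0ℚ) ≡ (if a ∧ s then y else 0ℚ)
  mask true  true  {y} = ℚ.*-identityʳ y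
  mask true  false {y} = ℚ.*-zeroʳ y
  mask false _         = refl

sumℚ-·𝟙 : ∀ (S : Subset m) f → sumℚ (f · 𝟙 S) ≡ ℕ→ℚ (∑ℕ⟨ S ⟩ f)
sumℚ-·𝟙 S f = trans (∑-·𝟙 (λ _ → true) S f) (∑-ℕ→ℚ S f)

𝟙∈[0,1] : ∀ (S : Subset m) i → 0ℚ ≤ℚ 𝟙 S i × 𝟙 S i ≤ℚ 1ℚ
𝟙∈[0,1] S i with S i
... | true  = 0≤ℕ→ℚ 1 , ℚ.≤-refl
... | false = ℚ.≤-refl , 0≤ℕ→ℚ 1

·-nonNeg : ∀ (f : Fin m → ℕ) {x} → (∀ i → 0ℚ ≤ℚ x i) → ∀ i → 0ℚ ≤ℚ (f · x) i
·-nonNeg f {x} 0≤x i = subst (_≤ℚ (f · x) i) (ℚ.*-zeroʳ (ℕ→ℚ (f i)))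
                             (ℚ.*-monoˡ-≤-nonNeg (ℕ→ℚ (f i)) {{ℚ.nonNegative (0≤ℕ→ℚ (f i))}} (0≤x i))

module _ {a ℓ} {A : Set a} {_≽_ : Rel A ℓ} (≽-total : Total _≽_) (≽-trans : Transitive _≽_) where

  private
    ≽-refl : ∀ {x} → x ≽ x
    ≽-refl {x} = reduce (≽-total x x)

  argmax : (e : Fin m → A) (P : Subset m) → P ⊆ ∅ ⊎ ∃ λ i → T (P i) × ∀ j → T (P j) → e i ≽ e j
  argmax {zero}  e P = inj₁ λ ()
  argmax {suc m} e P with argmax (e ∘ suc) (P ∘ suc) | T? (P zero)
  ... | inj₁ none            | no  0∉P = inj₁ λ { zero → 0∉P ; (suc j) → none j }
  ... | inj₁ none            | yes 0∈P = inj₂ (zero , 0∈P , λ { zero _ → ≽-refl ; (suc j) j∈P → ⊥-elim (none j j∈P) })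
  ... | inj₂ (i , i∈P , max) | no  0∉P = inj₂ (suc i , i∈P , λ { zero 0∈P → ⊥-elim (0∉P 0∈P) ; (suc j) → max j })
  ... | inj₂ (i , i∈P , max) | yes 0∈P with ≽-total (e zero) (e (suc i))
  ...   | inj₁ 0≽i = inj₂ (zero , 0∈P , λ { zero _ → ≽-refl ; (suc j) j∈P → ≽-trans 0≽i (max j j∈P) })
  ...   | inj₂ i≽0 = inj₂ (suc i , i∈P , λ { zero _ → i≽0 ; (suc j) → max j })

-- Permutations

injective⇒surjective : ∀ {f : Fin m → Fin m} → Injective _≡_ _≡_ f → ∀ y → ∃ λ x → f x ≡ y
injective⇒surjective {suc m} {f} f-inj y with Fin.any? (λ x → f x Fin.≟ y)
... | yes hit = hit
... | no miss = ⊥-elim (ℕ.1+n≰n (Fin.injective⇒≤ punchOut∘f-injective))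
  where
  y≢f : ∀ x → y ≢ f x
  y≢f x y≡fx = miss (x , sym y≡fx)
  punchOut∘f-injective : Injective _≡_ _≡_ (λ x → Fin.punchOut (y≢f x))
  punchOut∘f-injective eq = f-inj (Fin.punchOut-injective (y≢f _) (y≢f _) eq)

injective⇒↔ : ∀ {f : Fin m → Fin m} → Injective _≡_ _≡_ f → Σ (Fin m ↔ Fin m) λ σ → Inverse.to σ ≗ f
injective⇒↔ {f = f} f-inj = mk↔ₛ′ f (proj₁ ∘ surj) (proj₂ ∘ surj) (λ x → f-inj (proj₂ (surj (f x)))) , λ _ → refl
  where surj = injective⇒surjective f-inj

module _ (g : Fin m → ℕ) where

  private
    key : Fin m → ℕ
    key i = g i * m + toℕ i

    key-mono : ∀ {i j} → g i < g j → key i < key j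
    key-mono {i} {j} gi<gj = begin-strict
      g i * m + toℕ i  <⟨ ℕ.+-monoʳ-< (g i * m) (Fin.toℕ<n i) ⟩
      g i * m + m      ≡⟨ ℕ.+-comm (g i * m) m ⟩
      suc (g i) * m    ≤⟨ ℕ.*-monoˡ-≤ m gi<gj ⟩
      g j * m          ≤⟨ ℕ.m≤m+n (g j * m) (toℕ j) ⟩
      key j            ∎
      where open ℕ.≤-Reasoning

    key-injective : ∀ {i j} → key i ≡ key j → i ≡ j
    key-injective {i} {j} eq with ℕ.<-cmp (g i) (g j)
    ... | tri< gi<gj _ _ = ⊥-elim (ℕ.<-irrefl eq (key-mono gi<gj))
    ... | tri> _ _ gj<gi = ⊥-elim (ℕ.<-irrefl (sym eq) (key-mono gj<gi))
    ... | tri≈ _ gi≡gj _ =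
      Fin.toℕ-injective (ℕ.+-cancelˡ-≡ (g i * m) _ _ (trans eq (cong (λ k → k * m + toℕ j) (sym gi≡gj))))

    below : Fin m → Subset m
    below j i = key i <ᵇ key j

    rank : Fin m → ℕ
    rank j = ∣ below j ∣

    rank<m : ∀ j → rank j < m
    rank<m j = subst (rank j <_) (trans (sumℕ-const m 1) (ℕ.*-identityʳ m))
                     (∣∣-mono-⊂ j (λ _ _ → _) _ (ℕ.<-irrefl refl ∘ ℕ.<ᵇ⇒< (key j) (key j)))

    rank-mono : ∀ {i j} → key i < key j → rank i < rank j
    rank-mono {i} {j} ki<kj = ∣∣-mono-⊂ i below-i⊆below-j (ℕ.<⇒<ᵇ ki<kj) (ℕ.<-irrefl refl ∘ ℕ.<ᵇ⇒< (key i) (key i))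
      where
      below-i⊆below-j : below i ⊆ below j
      below-i⊆below-j l l<i = ℕ.<⇒<ᵇ (ℕ.<-trans (ℕ.<ᵇ⇒< (key l) (key i) l<i) ki<kj)

    rank-injective : ∀ {i j} → rank i ≡ rank j → i ≡ j
    rank-injective {i} {j} eq with ℕ.<-cmp (key i) (key j)
    ... | tri< ki<kj _ _ = ⊥-elim (ℕ.<-irrefl eq (rank-mono ki<kj))
    ... | tri≈ _ ki≡kj _ = key-injective ki≡kj
    ... | tri> _ _ kj<ki = ⊥-elim (ℕ.<-irrefl (sym eq) (rank-mono kj<ki))

    position : Fin m → Fin m
    position j = Fin.fromℕ< (rank<m j)

    toℕ-position : ∀ j → toℕ (position j) ≡ rank j
    toℕ-position j = Fin.toℕ-fromℕ< (rank<m j)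

    position-injective : Injective _≡_ _≡_ position
    position-injective {i} {j} eq =
      rank-injective (trans (sym (toℕ-position i)) (trans (cong toℕ eq) (toℕ-position j)))

  sorting-permutation : Σ (Fin m ↔ Fin m) λ σ → ∀ {i j} → g i < g j → toℕ (Inverse.to σ i) < toℕ (Inverse.to σ j)
  sorting-permutation = σ , λ {i} {j} gi<gj → subst₂ _<_ (sym (toℕ-σ i)) (sym (toℕ-σ j)) (rank-mono (key-mono gi<gj))
    where
    σ = proj₁ (injective⇒↔ position-injective)
    toℕ-σ : ∀ j → toℕ (Inverse.to σ j) ≡ rank j
    toℕ-σ j = trans (cong toℕ (proj₂ (injective⇒↔ position-injective) j)) (toℕ-position j)

-- Early sets of jobs

-- The sets q ∘ d are exactly the unions of due-date classes.
LoadDominated : (p d : Fin m → ℕ) (y x : Fin m → ℚ) → Set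
LoadDominated p d y x = ∀ q → ∑⟨ q ∘ d ⟩ (p · y) ≤ℚ ∑⟨ q ∘ d ⟩ (p · x)

module _ (J : Instance) where

  dueBy : ℕ → Subset (n J)
  dueBy D i = d J i ≤ᵇ D

  load : Subset (n J) → ℕ → ℕ
  load S D = ∑ℕ⟨ dueBy D ∩ S ⟩ p J

  early⇒load≤ : ∀ {S} → AllEarly J S → ∀ D → load S D ≤ D
  early⇒load≤ {S} (σ , early) D
    with argmax {_≽_ = _≥_} (λ a b → ℕ.≤-total b a) (flip ℕ.≤-trans) (toℕ ∘ Inverse.to σ) (dueBy D ∩ S)
  ... | inj₁ none = ℕ.≤-trans (ℕ.≤-trans (∑ℕ-mono-⊆ (p J) none) (ℕ.≤-reflexive (∑ℕ-∅ (p J)))) z≤n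
  ... | inj₂ (l , l∈ , last) = begin
    load S D  ≤⟨ ∑ℕ-mono-⊆ (p J) (λ i i∈ → ℕ.≤⇒≤ᵇ (last i i∈)) ⟩
    C J σ l   ≤⟨ early l (proj₂ (T-∧⁻ l∈)) ⟩
    d J l     ≤⟨ ℕ.≤ᵇ⇒≤ (d J l) D (proj₁ (T-∧⁻ l∈)) ⟩
    D         ∎
    where open ℕ.≤-Reasoning

  load≤⇒early : ∀ {S} → (∀ j → T (S j) → load S (d J j) ≤ d J j) → AllEarly J S
  load≤⇒early {S} load≤ = σ , λ j j∈S → ℕ.≤-trans (∑ℕ-mono-⊆ (p J) (earlier⊆ j j∈S)) (load≤ j j∈S)
    where
    -- earliest due date first, the jobs outside S last
    key : Fin (n J) → ℕ
    key i = if S i then d J i else suc (dmax J)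
    σ = proj₁ (sorting-permutation key)
    sorted = proj₂ (sorting-permutation key)
    earlier⊆ : ∀ j → T (S j) → (λ i → toℕ (Inverse.to σ i) ≤ᵇ toℕ (Inverse.to σ j)) ⊆ dueBy (d J j) ∩ S
    earlier⊆ j j∈S i i≼j = member (T? (S i)) (ℕ.≮⇒≥ (λ kj<ki → ℕ.<⇒≱ (sorted kj<ki) (ℕ.≤ᵇ⇒≤ _ _ i≼j)))
      where
      member : Dec (T (S i)) → key i ≤ key j → T ((dueBy (d J j) ∩ S) i)
      member (yes i∈S) ki≤kj = T-∧⁺ (ℕ.≤⇒≤ᵇ (subst₂ _≤_ (if-T i∈S) (if-T j∈S) ki≤kj)) i∈S
      member (no  i∉S) ki≤kj =
        ⊥-elim (ℕ.<-irrefl refl (ℕ.≤-trans (subst₂ _≤_ (if-F i∉S) (if-T j∈S) ki≤kj) (maxℕ-upper (d J) j)))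

  𝟙-load : ∀ S D → ∑⟨ dueBy D ⟩ (p J · 𝟙 S) ≡ ℕ→ℚ (load S D)
  𝟙-load S D = trans (∑-·𝟙 (dueBy D) S (p J)) (∑-ℕ→ℚ (dueBy D ∩ S) (p J))

  early⇒𝟙-feasible : ∀ {S} → AllEarly J S → FracFeasible J (𝟙 S)
  early⇒𝟙-feasible {S} early = 𝟙∈[0,1] S , λ j →
    subst (_≤ℚ ℕ→ℚ (d J j)) (sym (𝟙-load S (d J j))) (ℕ→ℚ-mono-≤ (early⇒load≤ early (d J j)))

  𝟙-feasible⇒early : ∀ {S} → FracFeasible J (𝟙 S) → AllEarly J S
  𝟙-feasible⇒early {S} (_ , load≤) = load≤⇒early λ j _ →
    ℕ→ℚ-cancel-≤ (subst (_≤ℚ ℕ→ℚ (d J j)) (𝟙-load S (d J j)) (load≤ j))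

  dominated⇒feasible : ∀ {x y} → (∀ i → 0ℚ ≤ℚ y i × y i ≤ℚ 1ℚ) → FracFeasible J x → LoadDominated (p J) (d J) y x →
                       FracFeasible J y
  dominated⇒feasible y∈[0,1] (_ , x-load≤) y≼x = y∈[0,1] , λ j → ℚ.≤-trans (y≼x (_≤ᵇ d J j)) (x-load≤ j)

  dueDates : List ℕ
  dueDates = deduplicate ℕ._≟_ (map (d J) (allFin (n J)))

  d∈dueDates : ∀ i → d J i ∈ dueDates
  d∈dueDates i = ∈-deduplicate⁺ ℕ._≟_ (∈-map⁺ (d J) (∈-allFin i))

-- Fractional knapsack

-- The exchange inequality for a single item, multiplied out by the size P and weight W of the
-- blocking item: chosen items (s) are at least as dense as it, unchosen items of the group (g)
-- at most as dense.
exchange : ∀ g s {P W pᵢ wᵢ xᵢ} → 0ℚ ≤ℚ xᵢ → xᵢ ≤ℚ 1ℚ → (T s → T g) →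
           (T s → W *ℚ pᵢ ≤ℚ wᵢ *ℚ P) → (T g → ¬ T s → wᵢ *ℚ P ≤ℚ W *ℚ pᵢ) →
           P *ℚ (if g then wᵢ *ℚ xᵢ else 0ℚ) +ℚ W *ℚ (if s then pᵢ else 0ℚ)
             ≤ℚ W *ℚ (if g then pᵢ *ℚ xᵢ else 0ℚ) +ℚ P *ℚ (if s then wᵢ else 0ℚ)
exchange true  true  {P} {W} {pᵢ} {wᵢ} {xᵢ} _ xᵢ≤1 _ chosen _ = begin
  P *ℚ (wᵢ *ℚ xᵢ) +ℚ W *ℚ pᵢ
    ≡⟨ solve 5 (λ P W p w x → P :* (w :* x) :+ W :* p := W :* p :* (con 1ℚ :- x) :+ (W :* (p :* x) :+ P :* (w :* x)))
               refl P W pᵢ wᵢ xᵢ ⟩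
  W *ℚ pᵢ *ℚ (1ℚ -ℚ xᵢ) +ℚ (W *ℚ (pᵢ *ℚ xᵢ) +ℚ P *ℚ (wᵢ *ℚ xᵢ))
    ≤⟨ ℚ.+-monoˡ-≤ _ (ℚ.*-monoʳ-≤-nonNeg (1ℚ -ℚ xᵢ) {{ℚ.nonNegative (p≤q⇒0≤q-p xᵢ≤1)}} (chosen _)) ⟩
  wᵢ *ℚ P *ℚ (1ℚ -ℚ xᵢ) +ℚ (W *ℚ (pᵢ *ℚ xᵢ) +ℚ P *ℚ (wᵢ *ℚ xᵢ))
    ≡⟨ solve 5 (λ P W p w x → w :* P :* (con 1ℚ :- x) :+ (W :* (p :* x) :+ P :* (w :* x)) := W :* (p :* x) :+ P :* w)
               refl P W pᵢ wᵢ xᵢ ⟩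
  W *ℚ (pᵢ *ℚ xᵢ) +ℚ P *ℚ wᵢ ∎
  where
  open ℚ.≤-Reasoning
  open +-*-Solver
exchange true  false {P} {W} {pᵢ} {wᵢ} {xᵢ} 0≤xᵢ _ _ _ unchosen = begin
  P *ℚ (wᵢ *ℚ xᵢ) +ℚ W *ℚ 0ℚ  ≡⟨ solve 4 (λ P W w x → P :* (w :* x) :+ W :* con 0ℚ := w :* P :* x) refl P W wᵢ xᵢ ⟩
  wᵢ *ℚ P *ℚ xᵢ               ≤⟨ ℚ.*-monoʳ-≤-nonNeg xᵢ {{ℚ.nonNegative 0≤xᵢ}} (unchosen _ (λ ())) ⟩
  W *ℚ pᵢ *ℚ xᵢ               ≡⟨ solve 4 (λ P W p x → W :* p :* x := W :* (p :* x) :+ P :* con 0ℚ) refl P W pᵢ xᵢ ⟩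
  W *ℚ (pᵢ *ℚ xᵢ) +ℚ P *ℚ 0ℚ  ∎
  where
  open ℚ.≤-Reasoning
  open +-*-Solver
exchange false true  _ _ s⇒g _ _ = ⊥-elim (s⇒g _)
exchange false false {P} {W} _ _ _ _ _ = ℚ.≤-reflexive (ℚ.+-comm (P *ℚ 0ℚ) (W *ℚ 0ℚ))

module Knapsack (p w : Fin m → ℕ) (x : Fin m → ℚ) (x∈[0,1] : ∀ i → 0ℚ ≤ℚ x i × x i ≤ℚ 1ℚ) (G : Subset m) where

  -- i ⪰ j: i is at least as dense (w/p) as j, where items of size 0 count as infinitely
  -- dense; treating them apart is what makes ⪰ transitive.
  infix 4 _⪰_
  _⪰_ : Fin m → Fin m → Set
  i ⪰ j = p i ≡ 0 ⊎ (0 < p j × w j * p i ≤ w i * p j)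

  ⪰-total : Total _⪰_
  ⪰-total i j with p i ℕ.≟ 0 | p j ℕ.≟ 0
  ... | yes pi≡0 | _        = inj₁ (inj₁ pi≡0)
  ... | no  _    | yes pj≡0 = inj₂ (inj₁ pj≡0)
  ... | no  pi≢0 | no  pj≢0 with ℕ.≤-total (w j * p i) (w i * p j)
  ...   | inj₁ i⪰j = inj₁ (inj₂ (ℕ.n≢0⇒n>0 pj≢0 , i⪰j))
  ...   | inj₂ j⪰i = inj₂ (inj₂ (ℕ.n≢0⇒n>0 pi≢0 , j⪰i))

  ⪰-trans : Transitive _⪰_
  ⪰-trans (inj₁ pi≡0)       _           = inj₁ pi≡0
  ⪰-trans (inj₂ (pj>0 , _)) (inj₁ pj≡0) = ⊥-elim (ℕ.<-irrefl (sym pj≡0) pj>0)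
  ⪰-trans {i} {j} {k} (inj₂ (pj>0 , i⪰j)) (inj₂ (pk>0 , j⪰k)) =
    inj₂ (pk>0 , ℕ.*-cancelʳ-≤ (w k * p i) (w i * p k) (p j) {{ℕ.>-nonZero pj>0}} (begin
      w k * p i * p j  ≡⟨ xy∙z≈xz∙y (w k) (p i) (p j) ⟩
      w k * p j * p i  ≤⟨ ℕ.*-monoˡ-≤ (p i) j⪰k ⟩
      w j * p k * p i  ≡⟨ xy∙z≈xz∙y (w j) (p k) (p i) ⟩
      w j * p i * p k  ≤⟨ ℕ.*-monoˡ-≤ (p k) i⪰j ⟩
      w i * p j * p k  ≡⟨ xy∙z≈xz∙y (w i) (p j) (p k) ⟩
      w i * p k * p j  ∎))
    where
    open ℕ.≤-Reasoning
    open import Algebra.Properties.CommutativeSemigroup ℕ.*-commutativeSemigroup using (xy∙z≈xz∙y)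

  ⪰⇒cross : ∀ {i j} → i ⪰ j → ℕ→ℚ (w j) *ℚ ℕ→ℚ (p i) ≤ℚ ℕ→ℚ (w i) *ℚ ℕ→ℚ (p j)
  ⪰⇒cross {i} {j} i⪰j = subst₂ _≤ℚ_ (ℕ→ℚ-homo-* (w j) (p i)) (ℕ→ℚ-homo-* (w i) (p j)) (ℕ→ℚ-mono-≤ (cross i⪰j))
    where
    cross : i ⪰ j → w j * p i ≤ w i * p j
    cross (inj₁ pi≡0) rewrite pi≡0 | ℕ.*-zeroʳ (w j) = z≤n
    cross (inj₂ (_ , wjpi≤wipj)) = wjpi≤wipj

  budget : ℚ
  budget = ∑⟨ G ⟩ (p · x)

  record Greedy (S : Subset m) : Set where
    field
      chosen⊆G : S ⊆ G
      fits     : ∑⟨ S ⟩ (ℕ→ℚ ∘ p) ≤ℚ budget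
      densest  : ∀ i j → T (S i) → T ((G ∖ S) j) → i ⪰ j

  data Halted (S : Subset m) : Set where
    exhausted : G ⊆ S → Halted S
    overflow  : ∀ r → T ((G ∖ S) r) → (∀ j → T ((G ∖ S) j) → r ⪰ j) →
                budget <ℚ ∑⟨ S ⟩ (ℕ→ℚ ∘ p) +ℚ ℕ→ℚ (p r) → Halted S

  greedy-∅ : Greedy ∅
  greedy-∅ = record
    { chosen⊆G = λ _ ()
    ; fits     = ∑-mono {A = ∅} {f = ℕ→ℚ ∘ p} (·-nonNeg p (proj₁ ∘ x∈[0,1])) (λ _ ()) (λ _ ())
    ; densest  = λ _ _ ()
    }

  G∖-shrinks : ∀ {S} r → G ∖ (S ∪ ⁅ r ⁆) ⊆ G ∖ S
  G∖-shrinks {S} r = ∖-antimono {A = G} (∪-⊆ˡ {A = S} {B = ⁅ r ⁆})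

  greedy-add : ∀ {S} r → Greedy S → T ((G ∖ S) r) → (∀ j → T ((G ∖ S) j) → r ⪰ j) →
               ∑⟨ S ⟩ (ℕ→ℚ ∘ p) +ℚ ℕ→ℚ (p r) ≤ℚ budget → Greedy (S ∪ ⁅ r ⁆)
  greedy-add {S} r gS r∈G∖S r-max r-fits = record
    { chosen⊆G = λ i → [ chosen⊆G i , (λ i∈⁅r⁆ → subst (T ∘ G) (sym (⁅⁆-sound i∈⁅r⁆)) r∈G) ]′ ∘ T-∨⁻
    ; fits     = subst (_≤ℚ budget) (sym p[S∪⁅r⁆]) r-fits
    ; densest  = λ i j i∈S∪⁅r⁆ j∈rest →
        [ (λ i∈S → densest i j i∈S (G∖-shrinks {S} r j j∈rest))
        , (λ i∈⁅r⁆ → subst (_⪰ j) (sym (⁅⁆-sound i∈⁅r⁆)) (r-max j (G∖-shrinks {S} r j j∈rest)))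
        ]′ (T-∨⁻ i∈S∪⁅r⁆)
    }
    where
    open Greedy gS
    r∈G = proj₁ (T-∖⁻ r∈G∖S)
    S∩⁅r⁆=∅ : Disjoint S ⁅ r ⁆
    S∩⁅r⁆=∅ i i∈S i∈⁅r⁆ = proj₂ (T-∖⁻ r∈G∖S) (subst (T ∘ S) (⁅⁆-sound i∈⁅r⁆) i∈S)
    p[S∪⁅r⁆] : ∑⟨ S ∪ ⁅ r ⁆ ⟩ (ℕ→ℚ ∘ p) ≡ ∑⟨ S ⟩ (ℕ→ℚ ∘ p) +ℚ ℕ→ℚ (p r)
    p[S∪⁅r⁆] = trans (∑-∪ (ℕ→ℚ ∘ p) S∩⁅r⁆=∅) (cong (∑⟨ S ⟩ (ℕ→ℚ ∘ p) +ℚ_) (∑-⁅⁆ (ℕ→ℚ ∘ p) r))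

  greedy-add-shrinks : ∀ {S} r → T ((G ∖ S) r) → ∣ G ∖ (S ∪ ⁅ r ⁆) ∣ < ∣ G ∖ S ∣
  greedy-add-shrinks {S} r r∈G∖S =
    ∣∣-mono-⊂ r (G∖-shrinks {S} r) r∈G∖S (λ r∈ → proj₂ (T-∖⁻ {G r} r∈) (T-∨⁺ (inj₂ (⁅⁆-complete r))))

  greedy : ∀ k {S} → ∣ G ∖ S ∣ ≤ k → Greedy S → ∃ λ S → Greedy S × Halted S
  greedy-continue : ∀ k {S} → ∣ G ∖ S ∣ < k → Greedy S → ∃ λ S → Greedy S × Halted S

  greedy k {S} size gS with argmax ⪰-total ⪰-trans id (G ∖ S)
  ... | inj₁ G∖S⊆∅ = S , gS , exhausted (∖⊆∅⇒⊆ G∖S⊆∅)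
  ... | inj₂ (r , r∈G∖S , r-max) with ∑⟨ S ⟩ (ℕ→ℚ ∘ p) +ℚ ℕ→ℚ (p r) ℚ.≤? budget
  ...   | no  r-overflows = S , gS , overflow r r∈G∖S r-max (ℚ.≰⇒> r-overflows)
  ...   | yes r-fits      = greedy-continue k (ℕ.<-≤-trans (greedy-add-shrinks r r∈G∖S) size)
                                            (greedy-add r gS r∈G∖S r-max r-fits)

  greedy-continue (suc k) size gS = greedy k (ℕ.≤-pred size) gS

  overflow-bound : ∀ {S r} → Greedy S → T ((G ∖ S) r) → (∀ j → T ((G ∖ S) j) → r ⪰ j) →
                   budget <ℚ ∑⟨ S ⟩ (ℕ→ℚ ∘ p) +ℚ ℕ→ℚ (p r) →
                   ∑⟨ G ⟩ (w · x) ≤ℚ ∑⟨ S ⟩ (ℕ→ℚ ∘ w) +ℚ ℕ→ℚ (w r)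
  overflow-bound {S} {r} gS r∈G∖S r-max r-overflows =
    ℚ.*-cancelˡ-≤-pos P {{ℕ→ℚ-pos pr>0}} (+-cancelʳ-≤ (W *ℚ pS) (begin
      P *ℚ ∑⟨ G ⟩ (w · x) +ℚ W *ℚ pS
        ≡⟨ sumℚ-linear P W (λ i → if G i then (w · x) i else 0ℚ) (λ i → if S i then ℕ→ℚ (p i) else 0ℚ) ⟨
      sumℚ (λ i → P *ℚ (if G i then (w · x) i else 0ℚ) +ℚ W *ℚ (if S i then ℕ→ℚ (p i) else 0ℚ))
        ≤⟨ sumℚ-mono (λ i → exchange (G i) (S i) {P} {W} {ℕ→ℚ (p i)} {ℕ→ℚ (w i)}
                                      (proj₁ (x∈[0,1] i)) (proj₂ (x∈[0,1] i)) (chosen⊆G i)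
                                      (λ i∈S → ⪰⇒cross (densest i r i∈S r∈G∖S))
                                      (λ i∈G i∉S → ⪰⇒cross (r-max i (T-∖⁺ i∈G i∉S)))) ⟩
      sumℚ (λ i → W *ℚ (if G i then (p · x) i else 0ℚ) +ℚ P *ℚ (if S i then ℕ→ℚ (w i) else 0ℚ))
        ≡⟨ sumℚ-linear W P (λ i → if G i then (p · x) i else 0ℚ) (λ i → if S i then ℕ→ℚ (w i) else 0ℚ) ⟩
      W *ℚ budget +ℚ P *ℚ wS
        ≤⟨ ℚ.+-monoˡ-≤ (P *ℚ wS) (ℚ.*-monoˡ-≤-nonNeg W {{ℚ.nonNegative (0≤ℕ→ℚ (w r))}} (ℚ.<⇒≤ r-overflows)) ⟩
      W *ℚ (pS +ℚ P) +ℚ P *ℚ wS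
        ≡⟨ solve 4 (λ P W pS wS → W :* (pS :+ P) :+ P :* wS := P :* (wS :+ W) :+ W :* pS) refl P W pS wS ⟩
      P *ℚ (wS +ℚ W) +ℚ W *ℚ pS ∎))
    where
    open Greedy gS
    open ℚ.≤-Reasoning
    open +-*-Solver
    P = ℕ→ℚ (p r)
    W = ℕ→ℚ (w r)
    pS = ∑⟨ S ⟩ (ℕ→ℚ ∘ p)
    wS = ∑⟨ S ⟩ (ℕ→ℚ ∘ w)
    pr>0 : 0 < p r
    pr>0 = ℕ.n≢0⇒n>0 λ pr≡0 → ℚ.<-irrefl refl (ℚ.<-≤-trans r-overflows
             (ℚ.≤-trans (ℚ.≤-reflexive (trans (cong (λ k → pS +ℚ ℕ→ℚ k) pr≡0) (ℚ.+-identityʳ pS))) fits))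

  halted-bound : ∀ {S} M → (∀ i → w i ≤ M) → Greedy S → Halted S →
                 ∑⟨ G ⟩ (w · x) ≤ℚ ∑⟨ S ⟩ (ℕ→ℚ ∘ w) +ℚ ℕ→ℚ M
  halted-bound {S} M w≤M _ (exhausted G⊆S) =
    ℚ.≤-trans (∑-mono (0≤ℕ→ℚ ∘ w) G⊆S (λ i _ → wx≤w i)) (p≤p+q (0≤ℕ→ℚ M))
    where
    wx≤w : ∀ i → (w · x) i ≤ℚ ℕ→ℚ (w i)
    wx≤w i = subst ((w · x) i ≤ℚ_) (ℚ.*-identityʳ (ℕ→ℚ (w i)))
                   (ℚ.*-monoˡ-≤-nonNeg (ℕ→ℚ (w i)) {{ℚ.nonNegative (0≤ℕ→ℚ (w i))}} (proj₂ (x∈[0,1] i)))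
  halted-bound {S} M w≤M gS (overflow r r∈G∖S r-max r-overflows) =
    ℚ.≤-trans (overflow-bound gS r∈G∖S r-max r-overflows) (ℚ.+-monoʳ-≤ (∑⟨ S ⟩ (ℕ→ℚ ∘ w)) (ℕ→ℚ-mono-≤ (w≤M r)))

  Rounded : ℕ → Set
  Rounded M = ∃ λ S → S ⊆ G × ∑⟨ S ⟩ (ℕ→ℚ ∘ p) ≤ℚ ∑⟨ G ⟩ (p · x) × ∑⟨ G ⟩ (w · x) ≤ℚ ∑⟨ S ⟩ (ℕ→ℚ ∘ w) +ℚ ℕ→ℚ M

  rounding : ∀ M → (∀ i → w i ≤ M) → Rounded M
  rounding M w≤M with greedy ∣ G ∖ ∅ ∣ ℕ.≤-refl greedy-∅
  ... | S , gS , halted = S , chosen⊆G , fits , halted-bound M w≤M gS halted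
    where open Greedy gS

-- Rounding by due-date classes

module DueDateRounding (p w d : Fin m → ℕ) (x : Fin m → ℚ) (x∈[0,1] : ∀ i → 0ℚ ≤ℚ x i × x i ≤ℚ 1ℚ)
                       (M : ℕ) (w≤M : ∀ i → w i ≤ M) where

  Rounds : Subset m → ℕ → Set
  Rounds U c = ∃ λ S → S ⊆ U
                     × (∀ q → ∑⟨ (q ∘ d) ∩ S ⟩ (ℕ→ℚ ∘ p) ≤ℚ ∑⟨ (q ∘ d) ∩ U ⟩ (p · x))
                     × ∑⟨ U ⟩ (w · x) ≤ℚ ∑⟨ S ⟩ (ℕ→ℚ ∘ w) +ℚ ℕ→ℚ (c * M)

  rounds-∅ : Rounds ∅ 0
  rounds-∅ = ∅ , (λ _ ())
           , (λ q → ∑-mono (·-nonNeg p (proj₁ ∘ x∈[0,1])) (λ _ → id) (λ i i∈ → ⊥-elim (proj₂ (T-∧⁻ {q (d i)} i∈))))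
           , ℚ.≤-trans (∑-mono {A = ∅} {f = w · x} (0≤ℕ→ℚ ∘ w) (λ _ ()) (λ _ ())) (p≤p+q ℚ.≤-refl)

  rounds-cong : ∀ {U V c} → U ≗ V → Rounds U c → Rounds V c
  rounds-cong {U} {V} U≗V (S , S⊆U , p-bound , w-bound) =
      S , (λ i → subst T (U≗V i) ∘ S⊆U i)
    , (λ q → subst (_ ≤ℚ_) (∑-cong (p · x) (λ i → cong (q (d i) ∧_) (U≗V i))) (p-bound q))
    , subst (_≤ℚ _) (∑-cong (w · x) U≗V) w-bound

  rounds-∪ : ∀ {G U c} v → Disjoint G U → (∀ i → T (G i) → d i ≡ v) →
             Knapsack.Rounded p w x x∈[0,1] G M → Rounds U c → Rounds (G ∪ U) (suc c)
  rounds-∪ {G} {U} {c} v G∩U=∅ G-due-v (SG , SG⊆G , pG-bound , wG-bound) (S , S⊆U , p-bound , w-bound) =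
    SG ∪ S , ∪-mono-⊆ {A = SG} {G} {S} {U} SG⊆G S⊆U , p-bound′ , w-bound′
    where
    SG∩S=∅ : Disjoint SG S
    SG∩S=∅ i i∈SG i∈S = G∩U=∅ i (SG⊆G i i∈SG) (S⊆U i i∈S)
    p-bound′ : ∀ q → ∑⟨ (q ∘ d) ∩ (SG ∪ S) ⟩ (ℕ→ℚ ∘ p) ≤ℚ ∑⟨ (q ∘ d) ∩ (G ∪ U) ⟩ (p · x)
    p-bound′ q = subst₂ _≤ℚ_ (sym (∑-∩-∪ {Q = q ∘ d} {SG} {S} (ℕ→ℚ ∘ p) SG∩S=∅))
                              (sym (∑-∩-∪ {Q = q ∘ d} {G} {U} (p · x) G∩U=∅))
                              (ℚ.+-mono-≤ group-bound (p-bound q))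
      where
      group-bound : ∑⟨ (q ∘ d) ∩ SG ⟩ (ℕ→ℚ ∘ p) ≤ℚ ∑⟨ (q ∘ d) ∩ G ⟩ (p · x)
      group-bound = ∑-∩-const-mono {Q = q ∘ d} {SG} {G} (q v) (λ i i∈G → cong q (G-due-v i i∈G)) SG⊆G pG-bound
    w-bound′ : ∑⟨ G ∪ U ⟩ (w · x) ≤ℚ ∑⟨ SG ∪ S ⟩ (ℕ→ℚ ∘ w) +ℚ ℕ→ℚ (suc c * M)
    w-bound′ = begin
      ∑⟨ G ∪ U ⟩ (w · x)                     ≡⟨ ∑-∪ {A = G} {U} (w · x) G∩U=∅ ⟩
      ∑⟨ G ⟩ (w · x) +ℚ ∑⟨ U ⟩ (w · x)       ≤⟨ ℚ.+-mono-≤ wG-bound w-bound ⟩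
      (wSG +ℚ ℕ→ℚ M) +ℚ (wS +ℚ ℕ→ℚ (c * M))  ≡⟨ solve 4 (λ a b c e → (a :+ b) :+ (c :+ e) := (a :+ c) :+ (b :+ e))
                                                        refl wSG (ℕ→ℚ M) wS (ℕ→ℚ (c * M)) ⟩
      (wSG +ℚ wS) +ℚ (ℕ→ℚ M +ℚ ℕ→ℚ (c * M))  ≡⟨ cong₂ _+ℚ_ (∑-∪ {A = SG} {S} (ℕ→ℚ ∘ w) SG∩S=∅)
                                                        (ℕ→ℚ-homo-+ M (c * M)) ⟨
      ∑⟨ SG ∪ S ⟩ (ℕ→ℚ ∘ w) +ℚ ℕ→ℚ (suc c * M) ∎
      where
      open ℚ.≤-Reasoning
      open +-*-Solver
      wSG = ∑⟨ SG ⟩ (ℕ→ℚ ∘ w)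
      wS  = ∑⟨ S ⟩ (ℕ→ℚ ∘ w)

  covered : List ℕ → Subset m
  covered Vs i = does (d i ∈? Vs)

  -- Only the jobs due at v that are not covered yet form the new class, so a repeated due
  -- date contributes an empty class.
  rounds-covered : ∀ Vs → Rounds (covered Vs) (length Vs)
  rounds-covered []       = rounds-∅
  rounds-covered (v ∷ Vs) =
    rounds-cong {c = suc (length Vs)} covered-∷
      (rounds-∪ {c = length Vs} v new∩covered=∅ new-due-v (Knapsack.rounding p w x x∈[0,1] new M w≤M)
                (rounds-covered Vs))
    where
    new : Subset m
    new = (λ i → d i ≡ᵇ v) ∖ covered Vs
    new∩covered=∅ : Disjoint new (covered Vs)
    new∩covered=∅ i i∈new = proj₂ (T-∖⁻ i∈new)
    new-due-v : ∀ i → T (new i) → d i ≡ v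
    new-due-v i i∈new = ℕ.≡ᵇ⇒≡ (d i) v (proj₁ (T-∖⁻ i∈new))
    covered-∷ : new ∪ covered Vs ≗ covered (v ∷ Vs)
    covered-∷ i = ∖-∪ (d i ≡ᵇ v) (covered Vs i)
      where
      ∖-∪ : ∀ a b → (a ∧ not b) ∨ b ≡ a ∨ b
      ∖-∪ true  true  = refl
      ∖-∪ true  false = refl
      ∖-∪ false _     = refl

  rounds-everything : ∀ {U c} → (∀ i → T (U i)) → Rounds U c →
                      ∃ λ S → LoadDominated p d (𝟙 S) x × sumℚ (w · x) ≤ℚ sumℚ (w · 𝟙 S) +ℚ ℕ→ℚ (c * M)
  rounds-everything {U} {c} U-full (S , _ , p-bound , w-bound) = S , p-bound′ , w-bound′
    where
    open ℚ.≤-Reasoning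
    U≗full : U ≗ (λ _ → true)
    U≗full i = Equivalence.to T-≡ (U-full i)
    p-bound′ : LoadDominated p d (𝟙 S) x
    p-bound′ q = begin
      ∑⟨ q ∘ d ⟩ (p · 𝟙 S)        ≡⟨ ∑-·𝟙 (q ∘ d) S p ⟩
      ∑⟨ (q ∘ d) ∩ S ⟩ (ℕ→ℚ ∘ p)  ≤⟨ p-bound q ⟩
      ∑⟨ (q ∘ d) ∩ U ⟩ (p · x)    ≡⟨ ∑-cong (p · x) (λ i → trans (cong (q (d i) ∧_) (U≗full i))
                                                                    (∧-identityʳ (q (d i)))) ⟩
      ∑⟨ q ∘ d ⟩ (p · x)          ∎
    w-bound′ : sumℚ (w · x) ≤ℚ sumℚ (w · 𝟙 S) +ℚ ℕ→ℚ (c * M)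
    w-bound′ = begin
      sumℚ (w · x)                     ≡⟨ ∑-cong (w · x) U≗full ⟨
      ∑⟨ U ⟩ (w · x)                   ≤⟨ w-bound ⟩
      ∑⟨ S ⟩ (ℕ→ℚ ∘ w) +ℚ ℕ→ℚ (c * M)  ≡⟨ cong (_+ℚ ℕ→ℚ (c * M)) (∑-·𝟙 (λ _ → true) S w) ⟨
      sumℚ (w · 𝟙 S) +ℚ ℕ→ℚ (c * M)    ∎

  rounding : ∀ Vs → (∀ i → d i ∈ Vs) →
             ∃ λ S → LoadDominated p d (𝟙 S) x × sumℚ (w · x) ≤ℚ sumℚ (w · 𝟙 S) +ℚ ℕ→ℚ (length Vs * M)
  rounding Vs d∈Vs =
    rounds-everything {c = length Vs} (λ i → Equivalence.from T-≡ (dec-true (d i ∈? Vs) (d∈Vs i))) (rounds-covered Vs)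

module _ (J : Instance) {k a : ℕ} {a′ : ℚ} where

  A≤A′ : IsA J k a → IsA' J k a′ → ℕ→ℚ a ≤ℚ a′
  A≤A′ ((S , S-early , pS≤k , refl) , _) (_ , a′-max) =
    subst (_≤ℚ a′) (sumℚ-·𝟙 S (w J))
          (a′-max (𝟙 S) (early⇒𝟙-feasible J S-early) (subst (_≤ℚ ℕ→ℚ k) (sym (sumℚ-·𝟙 S (p J))) (ℕ→ℚ-mono-≤ pS≤k)))

  rounding⇒≤A+ : ∀ {x c} → IsA J k a → FracFeasible J x → pFrac J x ≤ℚ ℕ→ℚ k →
                 (∃ λ S → LoadDominated (p J) (d J) (𝟙 S) x × wFrac J x ≤ℚ wFrac J (𝟙 S) +ℚ c) →
                 wFrac J x ≤ℚ ℕ→ℚ a +ℚ c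
  rounding⇒≤A+ {x} {c} (_ , a-max) x-feasible px≤k (S , 𝟙S≼x , w-bound) = begin
    wFrac J x            ≤⟨ w-bound ⟩
    wFrac J (𝟙 S) +ℚ c   ≡⟨ cong (_+ℚ c) (sumℚ-·𝟙 S (w J)) ⟩
    ℕ→ℚ (wSet J S) +ℚ c  ≤⟨ ℚ.+-monoˡ-≤ c (ℕ→ℚ-mono-≤ (a-max S S-early pS≤k)) ⟩
    ℕ→ℚ a +ℚ c           ∎
    where
    open ℚ.≤-Reasoning
    S-early = 𝟙-feasible⇒early J (dominated⇒feasible J (𝟙∈[0,1] S) x-feasible 𝟙S≼x)
    pS≤k = ℕ→ℚ-cancel-≤ (subst (_≤ℚ ℕ→ℚ k) (sumℚ-·𝟙 S (p J)) (ℚ.≤-trans (𝟙S≼x (λ _ → true)) px≤k))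

  A′≤A+d#wmax : IsA J k a → IsA' J k a′ → a′ ≤ℚ ℕ→ℚ a +ℚ ℕ→ℚ (dnum J * wmax J)
  A′≤A+d#wmax optimal ((x , x-feasible , px≤k , refl) , _) =
    rounding⇒≤A+ optimal x-feasible px≤k
      (DueDateRounding.rounding (p J) (w J) (d J) x (proj₁ x-feasible) (wmax J) (maxℕ-upper (w J))
                                (dueDates J) (d∈dueDates J))

lemma7 : (J : Instance) (k : ℕ) → k ≤ dmax J → (a : ℕ) (a' : ℚ) → IsA J k a → IsA' J k a' →
    (0ℚ ≤ℚ (a' -ℚ ℕ→ℚ a)) × ((a' -ℚ ℕ→ℚ a) ≤ℚ ℕ→ℚ (dnum J * wmax J))
lemma7 J k _ a a' optimal fractional-optimal =
  p≤q⇒0≤q-p (A≤A′ J optimal fractional-optimal) , q≤p+r⇒q-p≤r (A′≤A+d#wmax J optimal fractional-optimal)
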